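{- Let $G$ be a graph on $n$ vertices and let $r\ge 1$ be an integer with $r<\Delta(G)$. Then \[ cms_r(G)\le ms_r(G)\le \left\lfloor\frac{rn-1}{2}\right\rfloor. \]
   Context: All graphs are simple; $\Delta(G)$ is the maximum degree of $G$. For an integer $N$, $[N]=\{0,1,\dots,N-1\}$. An ordering of $G=(V,E)$ is a bijection $\ell:E\to[|E|]$; edges are consecutive (resp. cyclically consecutive) in $\ell$ if their labels are consecutive integers (resp. consecutive integers modulo $|E|$). A graph is $(\le r)$-regular if every vertex has degree at most $r$. $ms_r(\ell)$ (resp. $cms_r(\ell)$) is the largest $s$ such that every $s$ consecutive (resp. cyclically consecutive) edges of $\ell$ form a $(\le r)$-regular subgraph; $ms_r(G)$ and $cms_r(G)$ are the maxima of these over all orderings $\ell$ of $G$. -}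

module Defs where

open import Data.Nat using (ℕ; zero; suc; _+_; _≤_; _<_; _⊔_; _≤ᵇ_; _<ᵇ_)
open import Data.Fin using (Fin; toℕ)
open import Data.Fin.Properties using (_≟_)
open import Data.Bool using (Bool; true; false; if_then_else_; _∧_; _∨_)
open import Data.List using (List; map; foldr; allFin)
open import Data.Nat.ListAction using (sum)
open import Data.Product using (_×_; _,_; proj₁; proj₂; ∃)
open import Data.Sum using (_⊎_)
open import Relation.Binary.PropositionalEquality using (_≡_; _≢_)
open import Relation.Nullary.Decidable using (⌊_⌋)
open import Function.Bundles using (_⤖_; Bijection)

-- A simple graph on vertex set Fin n with m edges, given as an injective
-- family of unordered pairs (no loops, no repeated edges).  E(G) = Fin m.
record Graph (n m : ℕ) : Set where
  field
    edge    : Fin m → Fin n × Fin n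
    noLoop  : ∀ e → proj₁ (edge e) ≢ proj₂ (edge e)
    noMulti : ∀ e f →
      ((proj₁ (edge e) ≡ proj₁ (edge f)) × (proj₂ (edge e) ≡ proj₂ (edge f)))
        ⊎ ((proj₁ (edge e) ≡ proj₂ (edge f)) × (proj₂ (edge e) ≡ proj₁ (edge f)))
      → e ≡ f

open Graph public

count : {m : ℕ} → (Fin m → Bool) → ℕ
count {m} p = sum (map (λ e → if p e then 1 else 0) (allFin m))

incident : {n m : ℕ} → Graph n m → Fin m → Fin n → Bool
incident G e v = ⌊ proj₁ (edge G e) ≟ v ⌋ ∨ ⌊ proj₂ (edge G e) ≟ v ⌋

degIn : {n m : ℕ} → Graph n m → (Fin m → Bool) → Fin n → ℕ
degIn G S v = count (λ e → S e ∧ incident G e v)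

degree : {n m : ℕ} → Graph n m → Fin n → ℕ
degree G v = degIn G (λ _ → true) v

Δ : {n m : ℕ} → Graph n m → ℕ
Δ {n} G = foldr (λ v k → degree G v ⊔ k) 0 (allFin n)

LeRegular : {n m : ℕ} → Graph n m → ℕ → (Fin m → Bool) → Set
LeRegular G r S = ∀ v → degIn G S v ≤ r

Ordering : ℕ → Set
Ordering m = Fin m ⤖ Fin m

label : {m : ℕ} → Ordering m → Fin m → ℕ
label ℓ e = toℕ (Bijection.to ℓ e)

window : {m : ℕ} → Ordering m → ℕ → ℕ → Fin m → Bool
window ℓ i s e = (i ≤ᵇ label ℓ e) ∧ (label ℓ e <ᵇ i + s)

-- edges with labels i, i+1, ..., i+s-1 modulo m (for i < m, s ≤ m)
cwindow : {m : ℕ} → Ordering m → ℕ → ℕ → Fin m → Bool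
cwindow {m} ℓ i s e =
  ((i ≤ᵇ label ℓ e) ∧ (label ℓ e <ᵇ i + s)) ∨ (label ℓ e + m <ᵇ i + s)

MsGood : {n m : ℕ} → Graph n m → ℕ → Ordering m → ℕ → Set
MsGood {m = m} G r ℓ s =
  s ≤ m × (∀ i → i + s ≤ m → LeRegular G r (window ℓ i s))

CmsGood : {n m : ℕ} → Graph n m → ℕ → Ordering m → ℕ → Set
CmsGood {m = m} G r ℓ s =
  s ≤ m × (∀ (i : Fin m) → LeRegular G r (cwindow ℓ (toℕ i) s))

IsMax : (ℕ → Set) → ℕ → Set
IsMax P k = P k × (∀ j → P j → j ≤ k)

IsMs : {n m : ℕ} → Graph n m → ℕ → ℕ → Set
IsMs {m = m} G r = IsMax (λ s → ∃ λ (ℓ : Ordering m) → MsGood G r ℓ s)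

IsCms : {n m : ℕ} → Graph n m → ℕ → ℕ → Set
IsCms {m = m} G r = IsMax (λ s → ∃ λ (ℓ : Ordering m) → CmsGood G r ℓ s)

-- Cyclic windows contain the linear ones, so cms_r(G) ≤ ms_r(G).  For the second
-- bound let the s ≥ 1 edges labelled 0, …, s-1 and those labelled 1, …, s both
-- induce (≤ r)-regular subgraphs; since r < Δ(G), s < |E|.  By the handshake
-- lemma 2s ≤ rn.  If 2s = rn, both windows are exactly r-regular; they differ
-- only by removing the edge labelled 0 and adding the edge labelled s, so these
-- two edges have the same endpoints, contradicting simplicity.  Hence 2s ≤ rn - 1.
module Submission where

open import Defs
open import Data.Nat using (ℕ; _≤_; _<_; _*_; _∸_; _/_)
open import Data.Product using (_×_)

open import Data.Nat using (zero; suc; _+_; _⊔_; _≤ᵇ_; _<ᵇ_; _≡ᵇ_; z≤n; s≤s; z<s)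
open import Data.Nat.Properties hiding (_≟_)
open import Data.Nat.DivMod using (m*n/n≡m; /-monoˡ-≤)
open import Data.Nat.ListAction using () renaming (sum to listSum)
open import Data.Fin using (Fin; zero; suc; toℕ; fromℕ<; punchIn)
open import Data.Fin.Properties using (_≟_; toℕ-injective; toℕ-fromℕ<; toℕ<n; punchInᵢ≢i)
open import Data.Bool using (Bool; true; false; T; if_then_else_; _∧_; _∨_)
open import Data.Bool.Properties using (T-∧; T-∨; T-≡; ∧-distribʳ-∨)
open import Data.List using (List; []; _∷_; foldr; tabulate; allFin)
open import Data.List.Properties using (map-tabulate)
open import Data.Product using (_,_; proj₁; proj₂; ∃)
open import Data.Sum using (_⊎_; inj₁; inj₂)
open import Data.Empty using (⊥)
open import Function using (_∘_; id; Equivalence)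
open import Function.Bundles using (Bijection; _⇔_)
open import Relation.Binary.PropositionalEquality
open import Relation.Nullary using (¬_; yes; no; contradiction)
open import Relation.Nullary.Decidable using (⌊_⌋; toWitness; fromWitness)
open import Algebra.Properties.Semiring.Sum +-*-semiring
  using (sum; sum-cong-≗; sum-remove; sum-replicate-zero; ∑-comm; ∑-distrib-+; *-distribˡ-sum; *-distribʳ-sum)

open Equivalence using (to; from)

private
  variable
    n m r s : ℕ

+-≤-tight : ∀ {a b c d} → a ≤ c → b ≤ d → a + b ≡ c + d → a ≡ c × b ≡ d
+-≤-tight {a} {b} {c} {d} a≤c b≤d eq with m≤n⇒m<n∨m≡n a≤c
... | inj₁ a<c = contradiction eq (<⇒≢ (+-mono-<-≤ a<c b≤d))
... | inj₂ refl = refl , +-cancelˡ-≡ a b d eq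

sum-zero : {f : Fin n → ℕ} → (∀ i → f i ≡ 0) → sum f ≡ 0
sum-zero {n} f≡0 = trans (sum-cong-≗ f≡0) (sum-replicate-zero n)

sum-mono-≤ : {f g : Fin n → ℕ} → (∀ i → f i ≤ g i) → sum f ≤ sum g
sum-mono-≤ {zero} _ = z≤n
sum-mono-≤ {suc n} f≤g = +-mono-≤ (f≤g zero) (sum-mono-≤ (f≤g ∘ suc))

sum-≤-* : {f : Fin n → ℕ} → (∀ i → f i ≤ r) → sum f ≤ n * r
sum-≤-* {zero} _ = z≤n
sum-≤-* {suc n} f≤r = +-mono-≤ (f≤r zero) (sum-≤-* (f≤r ∘ suc))

sum≡*⇒≡ : {f : Fin n → ℕ} → (∀ i → f i ≤ r) → sum f ≡ n * r → ∀ i → f i ≡ r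
sum≡*⇒≡ {suc n} f≤r eq zero = proj₁ (+-≤-tight (f≤r zero) (sum-≤-* (f≤r ∘ suc)) eq)
sum≡*⇒≡ {suc n} f≤r eq (suc i) =
  sum≡*⇒≡ (f≤r ∘ suc) (proj₂ (+-≤-tight (f≤r zero) (sum-≤-* (f≤r ∘ suc)) eq)) i

listSum-tabulate : (f : Fin n → ℕ) → listSum (tabulate f) ≡ sum f
listSum-tabulate {zero} f = refl
listSum-tabulate {suc n} f = cong (f zero +_) (listSum-tabulate (f ∘ suc))

ind : Bool → ℕ
ind b = if b then 1 else 0

ind-T : ∀ {b} → T b → ind b ≡ 1
ind-T {true} _ = refl

ind-¬T : ∀ {b} → ¬ T b → ind b ≡ 0
ind-¬T {true} ¬b = contradiction _ ¬b
ind-¬T {false} _ = refl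

ind-injective : ∀ {a b} → ind a ≡ ind b → a ≡ b
ind-injective {true} {true} _ = refl
ind-injective {false} {false} _ = refl

ind-mono : ∀ {a b} → (T a → T b) → ind a ≤ ind b
ind-mono {true} a⇒b = ≤-reflexive (sym (ind-T (a⇒b _)))
ind-mono {false} _ = z≤n

ind-∧ : ∀ a b → ind (a ∧ b) ≡ ind a * ind b
ind-∧ true true = refl
ind-∧ true false = refl
ind-∧ false b = refl

ind-∨ : ∀ {a b} → (T a → ¬ T b) → ind (a ∨ b) ≡ ind a + ind b
ind-∨ {true} {true} disj = contradiction _ (disj _)
ind-∨ {true} {false} _ = refl
ind-∨ {false} _ = refl

module _ {m : ℕ} where

  count≡sum : (p : Fin m → Bool) → count p ≡ sum (ind ∘ p)
  count≡sum p = trans (cong listSum (map-tabulate id (ind ∘ p))) (listSum-tabulate (ind ∘ p))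

  count-cong : {p q : Fin m → Bool} → (∀ e → p e ≡ q e) → count p ≡ count q
  count-cong {p} {q} p≗q =
    trans (count≡sum p) (trans (sum-cong-≗ (cong ind ∘ p≗q)) (sym (count≡sum q)))

  count-mono : {p q : Fin m → Bool} → (∀ e → T (p e) → T (q e)) → count p ≤ count q
  count-mono {p} {q} p⊆q = begin
    count p           ≡⟨ count≡sum p ⟩
    sum (ind ∘ p)     ≤⟨ sum-mono-≤ (λ e → ind-mono (p⊆q e)) ⟩
    sum (ind ∘ q)     ≡⟨ count≡sum q ⟨
    count q           ∎
    where open ≤-Reasoning

  count-false : count {m} (λ _ → false) ≡ 0
  count-false = trans (count≡sum _) (sum-replicate-zero m)

  count-∨ : {p q : Fin m → Bool} → (∀ e → T (p e) → ¬ T (q e)) →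
    count (λ e → p e ∨ q e) ≡ count p + count q
  count-∨ {p} {q} disj = begin
    count (λ e → p e ∨ q e)           ≡⟨ count≡sum _ ⟩
    sum (λ e → ind (p e ∨ q e))       ≡⟨ sum-cong-≗ (λ e → ind-∨ (disj e)) ⟩
    sum (λ e → ind (p e) + ind (q e)) ≡⟨ ∑-distrib-+ (ind ∘ p) (ind ∘ q) ⟩
    sum (ind ∘ p) + sum (ind ∘ q)     ≡⟨ cong₂ _+_ (count≡sum p) (count≡sum q) ⟨
    count p + count q                 ∎
    where open ≡-Reasoning

count-unique : {p : Fin m → Bool} (f : Fin m) → (∀ e → T (p e) → e ≡ f) →
  count p ≡ ind (p f)
count-unique {suc m} {p} f unique = begin
  count p                                ≡⟨ count≡sum p ⟩
  sum (ind ∘ p)                          ≡⟨ sum-remove (ind ∘ p) ⟩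
  ind (p f) + sum (ind ∘ p ∘ punchIn f)  ≡⟨ cong (ind (p f) +_) (sum-zero elsewhere) ⟩
  ind (p f) + 0                          ≡⟨ +-identityʳ _ ⟩
  ind (p f)                              ∎
  where
  open ≡-Reasoning
  elsewhere : ∀ i → ind (p (punchIn f i)) ≡ 0
  elsewhere i = ind-¬T (punchInᵢ≢i f i ∘ unique (punchIn f i))

module _ {n m : ℕ} (G : Graph n m) where

  degIn-cong : {S S' : Fin m → Bool} → (∀ e → S e ≡ S' e) → ∀ v → degIn G S v ≡ degIn G S' v
  degIn-cong S≗S' v = count-cong (λ e → cong (_∧ incident G e v) (S≗S' e))

  degIn-mono : {S S' : Fin m → Bool} → (∀ e → T (S e) → T (S' e)) →
    ∀ v → degIn G S v ≤ degIn G S' v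
  degIn-mono {S} {S'} S⊆S' v = count-mono λ e x →
    let (Se , ev) = to (T-∧ {S e}) x in from (T-∧ {S' e}) (S⊆S' e Se , ev)

  degIn-∨ : {S S' : Fin m → Bool} → (∀ e → T (S e) → ¬ T (S' e)) →
    ∀ v → degIn G (λ e → S e ∨ S' e) v ≡ degIn G S v + degIn G S' v
  degIn-∨ {S} {S'} disj v = trans
    (count-cong (λ e → ∧-distribʳ-∨ (incident G e v) (S e) (S' e)))
    (count-∨ λ e x y → disj e (proj₁ (to (T-∧ {S e}) x)) (proj₁ (to (T-∧ {S' e}) y)))

  T-incident : ∀ e v → T (incident G e v) ⇔ (T ⌊ proj₁ (edge G e) ≟ v ⌋ ⊎ T ⌊ proj₂ (edge G e) ≟ v ⌋)
  T-incident e v = T-∨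

  incident⇒endpoint : ∀ e v → T (incident G e v) →
    proj₁ (edge G e) ≡ v ⊎ proj₂ (edge G e) ≡ v
  incident⇒endpoint e v x with to (T-incident e v) x
  ... | inj₁ p = inj₁ (toWitness p)
  ... | inj₂ q = inj₂ (toWitness q)

  incident-endpoint₁ : ∀ e → T (incident G e (proj₁ (edge G e)))
  incident-endpoint₁ e = from (T-incident e _) (inj₁ (fromWitness refl))

  incident-endpoint₂ : ∀ e → T (incident G e (proj₂ (edge G e)))
  incident-endpoint₂ e = from (T-incident e _) (inj₂ (fromWitness refl))

  count-incident : ∀ e → count (incident G e) ≡ 2
  count-incident e = trans (count-∨ endpoints-distinct)
    (cong₂ _+_ (count-endpoint (proj₁ (edge G e))) (count-endpoint (proj₂ (edge G e))))
    where
    endpoints-distinct : ∀ v → T ⌊ proj₁ (edge G e) ≟ v ⌋ → ¬ T ⌊ proj₂ (edge G e) ≟ v ⌋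
    endpoints-distinct v p q = noLoop G e (trans (toWitness p) (sym (toWitness q)))
    count-endpoint : ∀ a → count (λ v → ⌊ a ≟ v ⌋) ≡ 1
    count-endpoint a = trans (count-unique a (λ v p → sym (toWitness p))) (ind-T (fromWitness refl))

  incident-injective : ∀ {e f} → (∀ v → incident G e v ≡ incident G f v) → e ≡ f
  incident-injective {e} {f} e≗f
    with incident⇒endpoint f _ (subst T (e≗f _) (incident-endpoint₁ e))
       | incident⇒endpoint f _ (subst T (e≗f _) (incident-endpoint₂ e))
  ... | inj₁ p | inj₁ q = contradiction (trans (sym p) q) (noLoop G e)
  ... | inj₂ p | inj₂ q = contradiction (trans (sym p) q) (noLoop G e)
  ... | inj₁ p | inj₂ q = sym (noMulti G f e (inj₁ (p , q)))
  ... | inj₂ p | inj₁ q = sym (noMulti G f e (inj₂ (q , p)))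

  handshake : ∀ S → sum (degIn G S) ≡ count S * 2
  handshake S = begin
    sum (degIn G S)                                        ≡⟨ sum-cong-≗ (λ v → count≡sum (λ e → S e ∧ incident G e v)) ⟩
    sum (λ v → sum (λ e → ind (S e ∧ incident G e v)))    ≡⟨ ∑-comm (λ v e → ind (S e ∧ incident G e v)) ⟩
    sum (λ e → sum (λ v → ind (S e ∧ incident G e v)))    ≡⟨ sum-cong-≗ edge-contribution ⟩
    sum (λ e → ind (S e) * 2)                              ≡⟨ *-distribʳ-sum 2 (ind ∘ S) ⟨
    sum (ind ∘ S) * 2                                      ≡⟨ cong (_* 2) (count≡sum S) ⟨
    count S * 2                                            ∎
    where
    open ≡-Reasoning
    edge-contribution : ∀ e → sum (λ v → ind (S e ∧ incident G e v)) ≡ ind (S e) * 2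
    edge-contribution e = begin
      sum (λ v → ind (S e ∧ incident G e v))     ≡⟨ sum-cong-≗ (λ v → ind-∧ (S e) (incident G e v)) ⟩
      sum (λ v → ind (S e) * ind (incident G e v)) ≡⟨ *-distribˡ-sum (ind (S e)) (ind ∘ incident G e) ⟨
      ind (S e) * sum (ind ∘ incident G e)       ≡⟨ cong (ind (S e) *_) (trans (sym (count≡sum (incident G e))) (count-incident e)) ⟩
      ind (S e) * 2                              ∎

  leRegular⇒count*2≤r*n : {S : Fin m → Bool} → LeRegular G r S → count S * 2 ≤ r * n
  leRegular⇒count*2≤r*n {r} {S} deg≤r = subst₂ _≤_ (handshake S) (*-comm n r) (sum-≤-* deg≤r)

  leRegular-saturated : {S : Fin m → Bool} → LeRegular G r S → count S * 2 ≡ r * n →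
    ∀ v → degIn G S v ≡ r
  leRegular-saturated {r} {S} deg≤r full = sum≡*⇒≡ deg≤r (trans (handshake S) (trans full (*-comm r n)))

  Δ-≤ : LeRegular G r (λ _ → true) → Δ G ≤ r
  Δ-≤ {r} deg≤r = foldr-≤ (allFin n)
    where
    foldr-≤ : (vs : List (Fin n)) → foldr (λ v k → degree G v ⊔ k) 0 vs ≤ r
    foldr-≤ [] = z≤n
    foldr-≤ (v ∷ vs) = ⊔-lub (deg≤r v) (foldr-≤ vs)

<ᵇ-suc : ∀ x s → (x <ᵇ suc s) ≡ (x <ᵇ s) ∨ (x ≡ᵇ s)
<ᵇ-suc zero zero = refl
<ᵇ-suc zero (suc s) = refl
<ᵇ-suc (suc x) zero = refl
<ᵇ-suc (suc x) (suc s) = <ᵇ-suc x s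

<ᵇ-suc-shift : ∀ x s → (x <ᵇ suc s) ≡ (x ≡ᵇ 0) ∨ ((1 ≤ᵇ x) ∧ (x <ᵇ 1 + s))
<ᵇ-suc-shift zero s = refl
<ᵇ-suc-shift (suc x) s = refl

module _ {m : ℕ} (ℓ : Ordering m) where

  hasLabel : ℕ → Fin m → Bool
  hasLabel k e = label ℓ e ≡ᵇ k

  label-injective : ∀ {e f} → label ℓ e ≡ label ℓ f → e ≡ f
  label-injective = Bijection.injective ℓ ∘ toℕ-injective

  label-surjective : ∀ {k} → k < m → ∃ λ f → label ℓ f ≡ k
  label-surjective k<m with Bijection.strictlySurjective ℓ (fromℕ< k<m)
  ... | f , ℓf≡k = f , trans (cong toℕ ℓf≡k) (toℕ-fromℕ< k<m)

  hasLabel-unique : ∀ {k f} → label ℓ f ≡ k → ∀ e → T (hasLabel k e) → e ≡ f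
  hasLabel-unique {k} ℓf≡k e ℓe≡k = label-injective (trans (≡ᵇ⇒≡ (label ℓ e) k ℓe≡k) (sym ℓf≡k))

  hasLabel-self : ∀ {k f} → label ℓ f ≡ k → hasLabel k f ≡ true
  hasLabel-self {k} ℓf≡k = to T-≡ (≡⇒≡ᵇ _ k ℓf≡k)

  count-hasLabel : ∀ {k} → k < m → count (hasLabel k) ≡ 1
  count-hasLabel k<m with label-surjective k<m
  ... | f , ℓf≡k = trans (count-unique f (hasLabel-unique ℓf≡k))
                         (cong ind (hasLabel-self ℓf≡k))

  window-full : ∀ e → window ℓ 0 m e ≡ true
  window-full e = to T-≡ (<⇒<ᵇ (toℕ<n (Bijection.to ℓ e)))

  window-extend : ∀ s e → window ℓ 0 (suc s) e ≡ window ℓ 0 s e ∨ hasLabel s e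
  window-extend s e = <ᵇ-suc (label ℓ e) s

  window-shift : ∀ s e → window ℓ 0 (suc s) e ≡ hasLabel 0 e ∨ window ℓ 1 s e
  window-shift s e = <ᵇ-suc-shift (label ℓ e) s

  window-disjoint-last : ∀ s e → T (window ℓ 0 s e) → ¬ T (hasLabel s e)
  window-disjoint-last s e ℓe<s ℓe≡s =
    <-irrefl (≡ᵇ⇒≡ (label ℓ e) s ℓe≡s) (<ᵇ⇒< (label ℓ e) s ℓe<s)

  window-disjoint-first : ∀ s e → T (hasLabel 0 e) → ¬ T (window ℓ 1 s e)
  window-disjoint-first s e with label ℓ e
  ... | zero = λ _ ()
  ... | suc _ = λ ()

  count-window : s ≤ m → count (window ℓ 0 s) ≡ s
  count-window {zero} _ = count-false {m}
  count-window {suc s} s<m = begin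
    count (window ℓ 0 (suc s))                      ≡⟨ count-cong (window-extend s) ⟩
    count (λ e → window ℓ 0 s e ∨ hasLabel s e)     ≡⟨ count-∨ (window-disjoint-last s) ⟩
    count (window ℓ 0 s) + count (hasLabel s)       ≡⟨ cong₂ _+_ (count-window (<⇒≤ s<m)) (count-hasLabel s<m) ⟩
    s + 1                                           ≡⟨ +-comm s 1 ⟩
    suc s                                           ∎
    where open ≡-Reasoning

  count-window₁ : suc s ≤ m → count (window ℓ 1 s) ≡ s
  count-window₁ {s} s<m = suc-injective (begin
    suc (count (window ℓ 1 s))                      ≡⟨ cong (_+ count (window ℓ 1 s)) (count-hasLabel (≤-<-trans z≤n s<m)) ⟨
    count (hasLabel 0) + count (window ℓ 1 s)       ≡⟨ count-∨ (window-disjoint-first s) ⟨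
    count (λ e → hasLabel 0 e ∨ window ℓ 1 s e)     ≡⟨ count-cong (window-shift s) ⟨
    count (window ℓ 0 (suc s))                      ≡⟨ count-window s<m ⟩
    suc s                                           ∎)
    where open ≡-Reasoning

  window⊆cwindow : ∀ {i c} (i<m : i < m) e → T (window ℓ i c e) → T (cwindow ℓ (toℕ (fromℕ< i<m)) c e)
  window⊆cwindow {i} {c} i<m e w rewrite toℕ-fromℕ< i<m = from (T-∨ {window ℓ i c e}) (inj₁ w)

  window-start< : ∀ {i c} e → T (window ℓ i c e) → i < m
  window-start< {i} e w =
    ≤-<-trans (≤ᵇ⇒≤ i (label ℓ e) (proj₁ (to (T-∧ {i ≤ᵇ label ℓ e}) w))) (toℕ<n (Bijection.to ℓ e))

m*2<n⇒m≤[n∸1]/2 : ∀ {k} → s * 2 < k → s ≤ (k ∸ 1) / 2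
m*2<n⇒m≤[n∸1]/2 {s} {suc k} (s≤s s*2≤k) = subst (_≤ k / 2) (m*n/n≡m s 2) (/-monoˡ-≤ 2 s*2≤k)

module _ {n m : ℕ} (G : Graph n m) (ℓ : Ordering m) where

  degIn-hasLabel : ∀ {k f} → label ℓ f ≡ k → ∀ v → degIn G (hasLabel ℓ k) v ≡ ind (incident G f v)
  degIn-hasLabel {k} {f} ℓf≡k v = trans
    (count-unique f (λ e x → hasLabel-unique ℓ ℓf≡k e (proj₁ (to (T-∧ {hasLabel ℓ k e}) x))))
    (cong (λ b → ind (b ∧ incident G f v)) (hasLabel-self ℓ ℓf≡k))

  degIn-window-shift : ∀ {s f₀ fₛ} → label ℓ f₀ ≡ 0 → label ℓ fₛ ≡ s → ∀ v →
    degIn G (window ℓ 0 s) v + ind (incident G fₛ v) ≡ ind (incident G f₀ v) + degIn G (window ℓ 1 s) v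
  degIn-window-shift {s} {f₀} {fₛ} ℓf₀≡0 ℓfₛ≡s v = begin
    degIn G (window ℓ 0 s) v + ind (incident G fₛ v)     ≡⟨ cong (degIn G (window ℓ 0 s) v +_) (degIn-hasLabel ℓfₛ≡s v) ⟨
    degIn G (window ℓ 0 s) v + degIn G (hasLabel ℓ s) v  ≡⟨ degIn-∨ G (window-disjoint-last ℓ s) v ⟨
    degIn G (λ e → window ℓ 0 s e ∨ hasLabel ℓ s e) v    ≡⟨ degIn-cong G (λ e → trans (sym (window-extend ℓ s e)) (window-shift ℓ s e)) v ⟩
    degIn G (λ e → hasLabel ℓ 0 e ∨ window ℓ 1 s e) v    ≡⟨ degIn-∨ G (window-disjoint-first ℓ s) v ⟩
    degIn G (hasLabel ℓ 0) v + degIn G (window ℓ 1 s) v  ≡⟨ cong (_+ degIn G (window ℓ 1 s) v) (degIn-hasLabel ℓf₀≡0 v) ⟩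
    ind (incident G f₀ v) + degIn G (window ℓ 1 s) v     ∎
    where open ≡-Reasoning

  consecutive-windows-not-regular : 0 < s → s < m →
    (∀ v → degIn G (window ℓ 0 s) v ≡ r) → (∀ v → degIn G (window ℓ 1 s) v ≡ r) → ⊥
  consecutive-windows-not-regular {s} {r} 0<s s<m regular₀ regular₁
    with label-surjective ℓ (<-trans 0<s s<m) | label-surjective ℓ s<m
  ... | f₀ , ℓf₀≡0 | fₛ , ℓfₛ≡s = <⇒≢ 0<s (begin
    0              ≡⟨ ℓf₀≡0 ⟨
    label ℓ f₀     ≡⟨ cong (label ℓ) (incident-injective G same-endpoints) ⟩
    label ℓ fₛ     ≡⟨ ℓfₛ≡s ⟩
    s              ∎)
    where
    open ≡-Reasoning
    same-endpoints : ∀ v → incident G f₀ v ≡ incident G fₛ v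
    same-endpoints v = ind-injective (+-cancelʳ-≡ r _ _ (begin
      ind (incident G f₀ v) + r                         ≡⟨ cong (ind (incident G f₀ v) +_) (regular₁ v) ⟨
      ind (incident G f₀ v) + degIn G (window ℓ 1 s) v  ≡⟨ degIn-window-shift ℓf₀≡0 ℓfₛ≡s v ⟨
      degIn G (window ℓ 0 s) v + ind (incident G fₛ v)  ≡⟨ cong (_+ ind (incident G fₛ v)) (regular₀ v) ⟩
      r + ind (incident G fₛ v)                         ≡⟨ +-comm r _ ⟩
      ind (incident G fₛ v) + r                         ∎))

  msGood⇒< : r < Δ G → MsGood G r ℓ s → s < m
  msGood⇒< r<Δ (s≤m , windows) with m≤n⇒m<n∨m≡n s≤m
  ... | inj₁ s<m = s<m
  ... | inj₂ refl = contradiction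
    (Δ-≤ G (λ v → subst (_≤ _) (degIn-cong G (window-full ℓ) v) (windows 0 ≤-refl v)))
    (<⇒≱ r<Δ)

  msGood-bound : r < Δ G → MsGood G r ℓ s → s ≤ (r * n ∸ 1) / 2
  msGood-bound {s = zero} _ _ = z≤n
  msGood-bound {r} {s@(suc _)} r<Δ good@(s≤m , windows) =
    m*2<n⇒m≤[n∸1]/2 (≤∧≢⇒< edges≤ edges≢)
    where
    s<m : s < m
    s<m = msGood⇒< r<Δ good
    edges≤ : s * 2 ≤ r * n
    edges≤ = subst (λ k → k * 2 ≤ r * n) (count-window ℓ s≤m) (leRegular⇒count*2≤r*n G (windows 0 s≤m))
    edges≢ : s * 2 ≢ r * n
    edges≢ full = consecutive-windows-not-regular z<s s<m
      (leRegular-saturated G (windows 0 s≤m) (trans (cong (_* 2) (count-window ℓ s≤m)) full))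
      (leRegular-saturated G (windows 1 s<m) (trans (cong (_* 2) (count-window₁ ℓ s<m)) full))

  msGood-of-cmsGood : ∀ {c} → CmsGood G r ℓ c → MsGood G r ℓ c
  msGood-of-cmsGood {r} {c} (c≤m , cwindows) = c≤m , λ i _ → window-leRegular i
    where
    window-leRegular : ∀ i → LeRegular G r (window ℓ i c)
    window-leRegular i v with i <? m
    ... | yes i<m = ≤-trans (degIn-mono G (window⊆cwindow ℓ i<m) v) (cwindows (fromℕ< i<m) v)
    ... | no i≮m = ≤-trans (degIn-mono G (λ e → i≮m ∘ window-start< ℓ e) v)
                           (≤-trans (≤-reflexive (count-false {m})) z≤n)

lemma8 : ∀ {n m} (G : Graph n m) (r : ℕ) → 1 ≤ r → r < Δ G →
    ∀ c s → IsCms G r c → IsMs G r s →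
    c ≤ s × s ≤ (r * n ∸ 1) / 2
lemma8 G r _ r<Δ c s ((ℓc , cmsGood) , _) ((ℓs , msGood) , ms-maximal) =
  ms-maximal c (ℓc , msGood-of-cmsGood G ℓc cmsGood) , msGood-bound G ℓs r<Δ msGood
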